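{- Let $k,m,n$ be positive integers with $m<n$ and $t(m+j)=t(n+j)$ for all $0\leqslant j\leqslant k$. Then $$k\ll n^{3/4}(\log n)^{3/2},$$ where the implied constant is absolute.
   Context: For $n\ge1$, $t(n)$ is the rooted planar tree of $n$: $t(1)$ is the single-vertex tree; if $n=p_1^{a_1}\cdots p_s^{a_s}$ with primes $p_1<\dots<p_s$ and $a_i\ge1$, then $t(n)$ is a root with $s$ edges ordered left to right, the $i$-th edge leading to a copy of $t(a_i)$. $f\ll g$ means $|f|\le Cg$. -}

module Defs where

open import Data.Nat using (ℕ; zero; suc; _+_; _*_; _/_)
open import Data.Nat.Divisibility using (_∣?_)
open import Data.Nat.Primality using (prime?)
open import Data.List using (List; []; _∷_; map; upTo; concatMap)
open import Data.Bool using (Bool; true; false; _∧_; if_then_else_)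
open import Relation.Nullary.Decidable using (⌊_⌋)

data Tree : Set where
  node : List Tree → Tree

-- p-adic valuation v_p(n) for p = q+2 (p ≥ 2), computed with fuel.
-- With fuel ≥ n it equals the true multiplicity of p in n (n ≥ 1).
valGo : ℕ → ℕ → ℕ → ℕ
valGo zero    q n = zero
valGo (suc f) q zero = zero
valGo (suc f) q (suc n) =
  if ⌊ suc (suc q) ∣? suc n ⌋ then suc (valGo f q (suc n / suc (suc q))) else zero

val : ℕ → ℕ → ℕ
val q n = valGo n q n

-- exponents a_1, ..., a_s of n = p_1^a_1 ... p_s^a_s, primes p_1 < ... < p_s
-- in increasing order (only primes p with a_p ≥ 1 are listed).
exponents : ℕ → List ℕ
exponents n = concatMap step (upTo n)
  where
  step : ℕ → List ℕ
  step q with ⌊ prime? (suc (suc q)) ⌋ | val q n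
  ... | true  | suc a = suc a ∷ []
  ... | true  | zero  = []
  ... | false | _     = []

-- t with fuel: the recursion depth is bounded since each exponent a_i < n.
tGo : ℕ → ℕ → Tree
tGo zero    n = node []
tGo (suc f) n = node (map (tGo f) (exponents n))

-- t(n): t(1) is the single vertex; for n = ∏ p_i^a_i, a root with ordered
-- edges to t(a_1), ..., t(a_s).  Fuel n suffices for n ≥ 1.
t : ℕ → Tree
t n = tGo n n

-- Let d = n − m and let w = p^b be the smallest of the exact prime powers of 2, 3, 5, 7 in d,
-- so that w⁴ ≤ d. The first child of t(x) is a leaf when 2 ∥ x but not when 4 ∣ x, so some
-- a ∈ (b, b + 3] has t(a) ≠ t(b). Along the progression of shifts j ≤ k with p^a ∥ m + j, of
-- difference M = p^(a+1) ≤ 7⁴w, we have p^b ∥ n + j, and the subtree t(a) of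
-- t(m + j) = t(n + j) must be t(e) for an exponent e ≥ 2 of a prime q ≠ p in n + j. So each of
-- the k/M terms n + j has a square factor q² ≤ n + k, and as q² divides at most every q²-th
-- term while Σ 1/q² < 1, k/M ≪ √(n + k). Hence k ≪ √(n + k) w and k⁴ ≪ n³.
module Submission where

open import Defs
open import Data.Bool using (Bool; true; false; if_then_else_)
open import Data.Empty using (⊥-elim)
open import Data.List using (List; []; _∷_; map; length; upTo; concatMap)
open import Data.List.Extrema.Nat using (argmin; argmin-sel; f[argmin]≤f[⊤]; f[argmin]≤f[xs])
open import Data.List.Membership.Propositional using (_∈_; find; lose)
open import Data.List.Membership.Propositional.Properties
  using (∈-concatMap⁺; ∈-concatMap⁻; ∈-upTo⁺; ∈-map⁺; ∈-map⁻)
open import Data.List.Properties using (map-cong-local)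
open import Data.List.Relation.Unary.All as All using (All; []; _∷_)
open import Data.List.Relation.Unary.All.Properties as All using ()
open import Data.List.Relation.Unary.AllPairs using (_∷_)
open import Data.List.Relation.Unary.Any using (here; there)
open import Data.List.Relation.Unary.Unique.Propositional using (Unique)
open import Data.Nat
  using (ℕ; zero; suc; _+_; _*_; _^_; _∸_; _/_; _%_; _≤_; _<_; _≤′_; ≤′-refl; ≤′-step; z≤n; s≤s;
         z<s; NonZero; >-nonZero; >-nonZero⁻¹)
open import Data.Nat.Coprimality as Coprime using (Coprime; coprime-divisor)
open import Data.Nat.Divisibility
open import Data.Nat.DivMod
open import Data.Nat.Induction using (<-rec)
open import Data.Nat.ListAction using (product)
open import Data.Nat.Logarithm using (⌊log₂_⌋; ⌊log₂⌋-mono-≤; ⌊log₂[2^n]⌋≡n)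
open import Data.Nat.Primality using (Prime; prime; prime?; prime⇒irreducible)
open import Data.Nat.Primality.Factorisation using (factorise)
open import Data.Nat.Properties
open import Data.List.Relation.Unary.Unique.DecPropositional _≟_ using (unique?)
open import Data.Nat.Tactic.RingSolver using (solve-∀)
open import Data.Product using (∃; ∃-syntax; _×_; _,_; proj₂)
open import Data.Sum using (inj₁; inj₂; [_,_]′)
open import Function using (_∘_)
open import Relation.Binary.PropositionalEquality
  using (_≡_; _≢_; ≢-sym; refl; sym; trans; cong; cong₂; subst; subst₂; module ≡-Reasoning)
open import Relation.Nullary using (¬_; ¬?; yes; no; does; _×-dec_)
open import Relation.Nullary.Decidable using (from-yes)
open import Relation.Unary using (Decidable)

P : ℕ → ℕ
P q = suc (suc q)

1<P : ∀ q → 1 < P q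
1<P q = s≤s z<s

-- A record rather than a product, so that p and a can be inferred from the type p ^ a ∥ x.
infix 4 _^_∥_
record _^_∥_ (p a x : ℕ) : Set where
  constructor exact
  field
    ∥⇒∣ : p ^ a ∣ x
    ∥⇒∤ : ¬ p ^ suc a ∣ x
open _^_∥_

-- Valuations

n<2^n : ∀ n → n < 2 ^ n
n<2^n zero    = s≤s z≤n
n<2^n (suc n) = +-mono-≤ (m^n>0 2 n) (≤-trans (n<2^n n) (m≤m+n (2 ^ n) 0))

p∣p^e : ∀ p e .{{_ : NonZero e}} → p ∣ p ^ e
p∣p^e p (suc e) = m∣m*n (p ^ e)

^-monoʳ-∣ : ∀ p {u v} → u ≤ v → p ^ u ∣ p ^ v
^-monoʳ-∣ p {u} {v} u≤v = divides (p ^ (v ∸ u)) (begin-equality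
  p ^ v               ≡⟨ cong (p ^_) (m∸n+n≡m u≤v) ⟨
  p ^ (v ∸ u + u)     ≡⟨ ^-distribˡ-+-* p (v ∸ u) u ⟩
  p ^ (v ∸ u) * p ^ u ∎)
  where open ∣-Reasoning

p*p∣p^e : ∀ p {e} → 2 ≤ e → p * p ∣ p ^ e
p*p∣p^e p 2≤e = ∣-trans (∣-reflexive (cong (p *_) (sym (*-identityʳ p)))) (^-monoʳ-∣ p 2≤e)

P^a∣x⇒a<x : ∀ q a x .{{_ : NonZero x}} → P q ^ a ∣ x → a < x
P^a∣x⇒a<x q a x p^a∣x = begin-strict
  a       <⟨ n<2^n a ⟩
  2 ^ a   ≤⟨ ^-monoˡ-≤ a (s≤s (s≤s z≤n)) ⟩
  P q ^ a ≤⟨ ∣⇒≤ p^a∣x ⟩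
  x       ∎
  where open ≤-Reasoning

valGo-∣ : ∀ f q x → P q ^ valGo f q x ∣ x
valGo-∣ zero    q x       = divides x (sym (*-identityʳ x))
valGo-∣ (suc f) q zero    = divides 0 refl
valGo-∣ (suc f) q (suc n) with P q ∣? suc n
... | yes p∣x = m∣n/o⇒o*m∣n p∣x (valGo-∣ f q (suc n / P q))
... | no  _   = divides (suc n) (sym (*-identityʳ (suc n)))

valGo-≥ : ∀ f q x {a} .{{_ : NonZero x}} → a ≤ f → P q ^ a ∣ x → a ≤ valGo f q x
valGo-≥ f       q x       {zero}  _         _     = z≤n
valGo-≥ (suc f) q (suc n) {suc a} (s≤s a≤f) p^a∣x with P q ∣? suc n
... | yes p∣x = s≤s (valGo-≥ f q (suc n / P q) {{>-nonZero (m≥n⇒m/n>0 (∣⇒≤ p∣x))}} a≤f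
                       (m*n∣o⇒n∣o/m (P q) (P q ^ a) p^a∣x))
... | no  p∤x = ⊥-elim (p∤x (m*n∣⇒m∣ (P q) (P q ^ a) p^a∣x))

∣⇒val≢0 : ∀ q x .{{_ : NonZero x}} → P q ∣ x → NonZero (val q x)
∣⇒val≢0 q x p∣x =
  >-nonZero (valGo-≥ x q x (>-nonZero⁻¹ x) (∣-trans (∣-reflexive (*-identityʳ (P q))) p∣x))

val-∥ : ∀ q x .{{_ : NonZero x}} → P q ^ val q x ∥ x
val-∥ q x = exact (valGo-∣ x q x) λ p^1+v∣x →
  <-irrefl refl (valGo-≥ x q x (<⇒≤ (P^a∣x⇒a<x q _ x p^1+v∣x)) p^1+v∣x)

∥⇒nonZero : ∀ {p a x} → p ^ a ∥ x → NonZero x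
∥⇒nonZero {x = zero}  p^a∥0 = ⊥-elim (∥⇒∤ p^a∥0 (divides 0 refl))
∥⇒nonZero {x = suc _} _     = _

∥⇒val≡ : ∀ q x {a} → P q ^ a ∥ x → val q x ≡ a
∥⇒val≡ q x {a} p^a∥x@(exact p^a∣x p^1+a∤x) =
  ≤-antisym val≤a (valGo-≥ x q x (<⇒≤ (P^a∣x⇒a<x q a x p^a∣x)) p^a∣x)
  where
  instance
    x≢0 : NonZero x
    x≢0 = ∥⇒nonZero p^a∥x
  val≤a : val q x ≤ a
  val≤a with ≤-<-connex (val q x) a
  ... | inj₁ v≤a = v≤a
  ... | inj₂ a<v = ⊥-elim (p^1+a∤x (∣-trans (^-monoʳ-∣ (P q) a<v) (valGo-∣ x q x)))

∥-+ : ∀ {p b d x} → p ^ b ∥ d → p ^ suc b ∣ x → p ^ b ∥ x + d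
∥-+ {p} (exact p^b∣d p^1+b∤d) p^1+b∣x = exact
  (∣m∣n⇒∣m+n (∣-trans (∣n⇒∣m*n p ∣-refl) p^1+b∣x) p^b∣d)
  λ p^1+b∣x+d → p^1+b∤d (∣m+n∣m⇒∣n p^1+b∣x+d p^1+b∣x)

P^a∥P^a+c*P^[1+a] : ∀ q a c → P q ^ a ∥ P q ^ a + c * P q ^ suc a
P^a∥P^a+c*P^[1+a] q a c = exact (∣m∣n⇒∣m+n ∣-refl (∣n⇒∣m*n c (n∣m*n (P q)))) λ p^1+a∣ →
  <⇒≱ (^-monoʳ-< (P q) (1<P q) (n<1+n a))
      (∣⇒≤ {{m^n≢0 (P q) a}} (∣m+n∣m⇒∣n (∣-trans p^1+a∣ (∣-reflexive (+-comm (P q ^ a) _))) (n∣m*n c)))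

-- Primes and coprimality

coprime-*ʳ : ∀ {a b c} → Coprime a b → Coprime a c → Coprime a (b * c)
coprime-*ʳ a⊥b a⊥c (i∣a , i∣bc) =
  a⊥c (i∣a , coprime-divisor (λ (k∣i , k∣b) → a⊥b (∣-trans k∣i i∣a , k∣b)) i∣bc)

coprime-^ʳ : ∀ {a b} j → Coprime a b → Coprime a (b ^ j)
coprime-^ʳ zero    _   (_ , i∣1) = ∣1⇒≡1 i∣1
coprime-^ʳ (suc j) a⊥b = coprime-*ʳ a⊥b (coprime-^ʳ j a⊥b)

coprime-^ : ∀ {a b} i j → Coprime a b → Coprime (a ^ i) (b ^ j)
coprime-^ i j a⊥b = Coprime.sym (coprime-^ʳ i (Coprime.sym (coprime-^ʳ j a⊥b)))

coprime-product : ∀ {a xs} → All (Coprime a) xs → Coprime a (product xs)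
coprime-product []           (_ , i∣1) = ∣1⇒≡1 i∣1
coprime-product (a⊥x ∷ a⊥xs) = coprime-*ʳ a⊥x (coprime-product a⊥xs)

coprime-∣⇒*∣ : ∀ {a b d} → Coprime a b → a ∣ d → b ∣ d → a * b ∣ d
coprime-∣⇒*∣ {a} {b} a⊥b (divides e refl) b∣ea
  with divides f refl ← coprime-divisor (Coprime.sym a⊥b) (∣-trans b∣ea (∣-reflexive (*-comm e a)))
  = divides f (trans (*-assoc f b a) (cong (f *_) (*-comm b a)))

prime∤⇒coprime : ∀ {p n} → Prime p → ¬ p ∣ n → Coprime p n
prime∤⇒coprime p-prime p∤n (i∣p , i∣n) with prime⇒irreducible p-prime i∣p
... | inj₁ i≡1  = i≡1
... | inj₂ refl = ⊥-elim (p∤n i∣n)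

prime∣prime⇒≡ : ∀ {p r} → Prime p → Prime r → p ∣ r → p ≡ r
prime∣prime⇒≡ p-prime r-prime p∣r with prime⇒irreducible r-prime p∣r
... | inj₁ refl = ⊥-elim (¬prime[1] p-prime)
  where
  ¬prime[1] : ¬ Prime 1
  ¬prime[1] (prime {{()}} _)
... | inj₂ p≡r  = p≡r

prime⇒≡P : ∀ {p} → Prime p → ∃[ q ] p ≡ P q
prime⇒≡P {suc (suc q)} _               = q , refl
prime⇒≡P {0}           (prime {{()}} _)
prime⇒≡P {1}           (prime {{()}} _)

prime-factor : ∀ a → 2 ≤ a → ∃[ q ] Prime (P q) × P q ∣ a
prime-factor 1               (s≤s ())
prime-factor a@(suc (suc _)) _ with factorise a
... | record { factors = r ∷ rs ; isFactorisation = a≡r*rs ; factorsPrime = r-prime ∷ _ }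
    with q , refl ← prime⇒≡P r-prime =
  q , r-prime , divides (product rs) (trans a≡r*rs (*-comm (P q) (product rs)))

primePowers-product-∣ : ∀ d qs → Unique qs → All (Prime ∘ P) qs →
                        product (map (λ q → P q ^ val q d) qs) ∣ d
primePowers-product-∣ d []       _             _                  = divides d (sym (*-identityʳ d))
primePowers-product-∣ d (q ∷ qs) (q∉qs ∷ uniq) (q-prime ∷ qs-prime) =
  coprime-∣⇒*∣ (coprime-product (All.map⁺ (All.zipWith coprime (q∉qs , qs-prime))))
               (valGo-∣ d q d) (primePowers-product-∣ d qs uniq qs-prime)
  where
  coprime : ∀ {r} → q ≢ r × Prime (P r) → Coprime (P q ^ val q d) (P r ^ val r d)
  coprime {r} (q≢r , r-prime) = coprime-^ (val q d) (val r d)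
    (prime∤⇒coprime q-prime (q≢r ∘ suc-injective ∘ suc-injective ∘ prime∣prime⇒≡ q-prime r-prime))

^-length≤product : ∀ {A : Set} (f : A → ℕ) {w} xs → All (λ x → w ≤ f x) xs →
                   w ^ length xs ≤ product (map f xs)
^-length≤product f []       []           = ≤-refl
^-length≤product f (x ∷ xs) (w≤fx ∷ w≤f) = *-mono-≤ w≤fx (^-length≤product f xs w≤f)

smallest-prime-power : ∀ d .{{_ : NonZero d}} q qs → Unique (q ∷ qs) → All (Prime ∘ P) (q ∷ qs) →
                       ∃[ q* ] q* ∈ q ∷ qs × (P q* ^ val q* d) ^ length (q ∷ qs) ≤ d
smallest-prime-power d q qs uniq primes = q* , q*∈ , ≤-trans
  (^-length≤product f (q ∷ qs) (f[argmin]≤f[⊤] {f = f} q qs ∷ f[argmin]≤f[xs] {f = f} q qs))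
  (∣⇒≤ (primePowers-product-∣ d (q ∷ qs) uniq primes))
  where
  f : ℕ → ℕ
  f r = P r ^ val r d
  q* : ℕ
  q* = argmin f q qs
  q*∈ : q* ∈ q ∷ qs
  q*∈ = [ here , there ]′ (argmin-sel f q qs)

-- The trees t(n)

∈-exponents⁻ : ∀ {x e} → e ∈ exponents x → ∃[ q ] Prime (P q) × NonZero e × val q x ≡ e
∈-exponents⁻ {x} e∈ with find (∈-concatMap⁻ _ {xs = upTo x} e∈)
... | q , _ , e∈block with prime? (P q) | val q x in v≡ | e∈block
... | yes p-prime | suc _ | here refl = q , p-prime , _ , v≡
... | yes _       | zero  | ()
... | no  _       | _     | ()

-- Exposes the block f x of concatMap f xs through an equation, so that a later with can
-- evaluate it: the local function that exponents maps over cannot be named here.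
∈-concatMap-block : ∀ {A B : Set} {f : A → List B} {xs ys} → ys ≡ concatMap f xs →
                    ∀ {x} → x ∈ xs → ∃[ l ] l ≡ f x × (∀ {y} → y ∈ l → y ∈ ys)
∈-concatMap-block {f = f} refl {x} x∈ = f x , refl , λ y∈ → ∈-concatMap⁺ f (lose x∈ y∈)

val≢0⇒≢0 : ∀ q x → NonZero (val q x) → NonZero x
val≢0⇒≢0 q (suc x) _ = _

∈-exponents⁺ : ∀ {q x} → Prime (P q) → NonZero (val q x) → val q x ∈ exponents x
∈-exponents⁺ {q} {x} p-prime v≢0
  with ∈-concatMap-block {xs = upTo x} (refl {x = exponents x}) (∈-upTo⁺ q<x)
  where
  instance
    x≢0 : NonZero x
    x≢0 = val≢0⇒≢0 q x v≢0
  q<x : q < x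
  q<x = <⇒≤ (∣⇒≤ (∣-trans (p∣p^e (P q) (val q x) {{v≢0}}) (valGo-∣ x q x)))
... | _ , block≡ , into with prime? (P q) | val q x | block≡
... | yes _   | suc _ | refl = into (here refl)
... | no  ¬pr | _     | _    = ⊥-elim (¬pr p-prime)

∈-exponents⇒< : ∀ {x e} → e ∈ exponents x → e < x
∈-exponents⇒< {x} e∈ with q , _ , e≢0 , refl ← ∈-exponents⁻ {x} e∈ =
  P^a∣x⇒a<x q _ x {{val≢0⇒≢0 q x e≢0}} (valGo-∣ x q x)

tGo-fuel : ∀ {f g x} → x ≤ f → x ≤ g → tGo f x ≡ tGo g x
tGo-fuel {zero}  {zero}          _   _   = refl
tGo-fuel {zero}  {suc g}         z≤n _   = refl
tGo-fuel {suc f} {zero}          _   z≤n = refl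
tGo-fuel {suc f} {suc g} {x} x≤f x≤g =
  cong node (map-cong-local (All.tabulate λ e∈ → tGo-fuel (below x≤f e∈) (below x≤g e∈)))
  where
  below : ∀ {h e} → x ≤ suc h → e ∈ exponents x → e ≤ h
  below x≤h e∈ = ≤-pred (≤-trans (∈-exponents⇒< e∈) x≤h)

t-unfold : ∀ x → t x ≡ node (map t (exponents x))
t-unfold zero    = refl
t-unfold (suc x) =
  cong node (map-cong-local (All.tabulate λ e∈ → tGo-fuel (≤-pred (∈-exponents⇒< e∈)) ≤-refl))

children : Tree → List Tree
children (node ts) = ts

leaf : Tree
leaf = node []

t≡⇒children≡ : ∀ {x y} → t x ≡ t y → map t (exponents x) ≡ map t (exponents y)
t≡⇒children≡ {x} {y} t[x]≡t[y] =
  cong children (trans (sym (t-unfold x)) (trans t[x]≡t[y] (t-unfold y)))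

t≢leaf : ∀ {a} → 2 ≤ a → t a ≢ leaf
t≢leaf {1}               (s≤s ())
t≢leaf {a@(suc (suc _))} 2≤a t[a]≡leaf
  with q , p-prime , p∣a ← prime-factor a 2≤a
  with () ← subst (t (val q a) ∈_) (cong children (trans (sym (t-unfold a)) t[a]≡leaf))
                  (∈-map⁺ t (∈-exponents⁺ {x = a} p-prime (∣⇒val≢0 q a p∣a)))

same-shape⇒square-factor : ∀ {x y q} → Prime (P q) → t x ≡ t y → 2 ≤ val q x → t (val q x) ≢ t (val q y) →
                           ∃[ q′ ] Prime (P q′) × q′ ≢ q × P q′ * P q′ ∣ y
same-shape⇒square-factor {x} {y} {q} p-prime t[x]≡t[y] 2≤v t[v]≢t[w]
  with e , e∈ , t[v]≡t[e] ← ∈-map⁻ t (subst (t (val q x) ∈_) (t≡⇒children≡ t[x]≡t[y])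
                              (∈-map⁺ t (∈-exponents⁺ {x = x} p-prime (>-nonZero (≤-trans z<s 2≤v)))))
  with q′ , q′-prime , e≢0 , refl ← ∈-exponents⁻ {y} e∈
  = q′ , q′-prime , q′≢q , ∣-trans (p*p∣p^e (P q′) (2≤e e≢0 e≢1)) (valGo-∣ y q′ y)
  where
  q′≢q : q′ ≢ q
  q′≢q refl = t[v]≢t[w] t[v]≡t[e]
  e≢1 : val q′ y ≢ 1
  e≢1 e≡1 = t≢leaf 2≤v (trans t[v]≡t[e] (cong t e≡1))
  2≤e : ∀ {e} → NonZero e → e ≢ 1 → 2 ≤ e
  2≤e {1}           _ e≢1 = ⊥-elim (e≢1 refl)
  2≤e {suc (suc _)} _ _   = s≤s (s≤s z≤n)

exponents-head : ∀ x → NonZero (val 0 x) → ∃[ es ] exponents x ≡ val 0 x ∷ es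
exponents-head (suc x) _ with val 0 (suc x)
... | suc _ = _ , refl

t-head : ∀ {x es} → exponents x ≡ val 0 x ∷ es → t x ≡ node (t (val 0 x) ∷ map t es)
t-head {x} es≡ = trans (t-unfold x) (cong (node ∘ map t) es≡)

firstChildIsLeaf : Tree → Bool
firstChildIsLeaf (node (node [] ∷ _)) = true
firstChildIsLeaf _                    = false

firstChildIsLeaf-4∣ : ∀ x → 4 ∣ x → firstChildIsLeaf (t x) ≡ false
firstChildIsLeaf-4∣ zero      _   = refl
firstChildIsLeaf-4∣ x@(suc _) 4∣x =
  trans (cong firstChildIsLeaf (t-head (proj₂ (exponents-head x (>-nonZero (≤-trans z<s 2≤v))))))
        (nonLeaf-head (t≢leaf 2≤v))
  where
  2≤v : 2 ≤ val 0 x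
  2≤v = valGo-≥ x 0 x (≤-trans (s≤s (s≤s z≤n)) (∣⇒≤ 4∣x)) 4∣x
  nonLeaf-head : ∀ {T ts} → T ≢ leaf → firstChildIsLeaf (node (T ∷ ts)) ≡ false
  nonLeaf-head {node []}      T≢leaf = ⊥-elim (T≢leaf refl)
  nonLeaf-head {node (_ ∷ _)} _      = refl

firstChildIsLeaf-2∥ : ∀ x → P 0 ^ 1 ∥ x → firstChildIsLeaf (t x) ≡ true
firstChildIsLeaf-2∥ x 2∥x =
  let v≡1     = ∥⇒val≡ 0 x {1} 2∥x
      es , es≡ = exponents-head x (subst NonZero (sym v≡1) _)
  in cong firstChildIsLeaf (trans (t-head es≡) (cong (λ v → node (t v ∷ map t es)) v≡1))

firstChildIsLeaf-≢ : ∀ {T U} → firstChildIsLeaf T ≡ true → firstChildIsLeaf U ≡ false → T ≢ U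
firstChildIsLeaf-≢ leafT nonLeafU refl with () ← trans (sym leafT) nonLeafU

shift-to-residue : ∀ m {M A} .{{_ : NonZero M}} → A < M → ∃[ j ] j < M × ∃[ c ] m + j ≡ A + c * M
shift-to-residue zero    {A = A} A<M = A , A<M , 0 , sym (+-identityʳ A)
shift-to-residue (suc m) {suc M′} {A} A<M with shift-to-residue m A<M
... | suc j , j<M , c , m+j≡ = j , <⇒≤ j<M , c , trans (sym (+-suc m j)) m+j≡
... | zero  , _   , c , m+0≡ = M′ , ≤-refl , suc c , (begin
  suc m + M′                ≡⟨ +-suc m M′ ⟨
  m + suc M′                ≡⟨ cong (_+ suc M′) (trans (sym (+-identityʳ m)) m+0≡) ⟩
  A + c * suc M′ + suc M′   ≡⟨ +-assoc A _ (suc M′) ⟩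
  A + (c * suc M′ + suc M′) ≡⟨ cong (A +_) (+-comm (c * suc M′) (suc M′)) ⟩
  A + suc c * suc M′        ∎)
  where open ≡-Reasoning

shifted-distinct-shape : ∀ b {j} → j < 4 → t (b + j) ≢ t b → (b < b + j → 2 ≤ b + j) →
                         ∃[ a ] b < a × a ≤ b + 3 × 2 ≤ a × t a ≢ t b
shifted-distinct-shape b {zero}  _   t≢ _   = ⊥-elim (t≢ (cong t (+-identityʳ b)))
shifted-distinct-shape b {suc j} j<4 t≢ 2≤a =
  b + suc j , b<a , +-monoʳ-≤ b (≤-pred j<4) , 2≤a b<a , t≢
  where
  b<a : b < b + suc j
  b<a = m<m+n b (s≤s z≤n)

nearby-distinct-shape : ∀ b → ∃[ a ] b < a × a ≤ b + 3 × 2 ≤ a × t a ≢ t b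
nearby-distinct-shape b with firstChildIsLeaf (t b) in leafb
... | true with j , j<4 , c , b+j≡ ← shift-to-residue b {4} {0} (s≤s z≤n) =
  shifted-distinct-shape b j<4 (≢-sym (firstChildIsLeaf-≢ leafb (firstChildIsLeaf-4∣ (b + j) 4∣b+j)))
    (λ b<b+j → ≤-trans (s≤s (s≤s z≤n)) (∣⇒≤ {{>-nonZero (≤-trans z<s b<b+j)}} 4∣b+j))
  where
  4∣b+j : 4 ∣ b + j
  4∣b+j = divides c b+j≡
... | false with j , j<4 , c , b+j≡ ← shift-to-residue b {4} {P 0 ^ 1} (s≤s (s≤s (s≤s z≤n))) =
  shifted-distinct-shape b j<4 (firstChildIsLeaf-≢ (firstChildIsLeaf-2∥ (b + j) 2∥b+j) leafb)
    (λ _ → subst (2 ≤_) (sym b+j≡) (m≤m+n 2 (c * 4)))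
  where
  2∥b+j : P 0 ^ 1 ∥ b + j
  2∥b+j = subst (P 0 ^ 1 ∥_) (sym b+j≡) (P^a∥P^a+c*P^[1+a] 0 1 c)

-- Counting sparse hits

countBelow : ∀ {A : ℕ → Set} → Decidable A → ℕ → ℕ
countBelow A? zero    = 0
countBelow A? (suc L) = countBelow A? L + (if does (A? L) then 1 else 0)

sumBelow : (ℕ → ℕ) → ℕ → ℕ
sumBelow f zero    = 0
sumBelow f (suc R) = sumBelow f R + f R

Sparse : ℕ → (ℕ → Set) → Set
Sparse G A = ∀ {i j} → i < j → A i → A j → i + G ≤ j

module _ {A : ℕ → Set} (A? : Decidable A) where

  countBelow-stable : ∀ {L₀ L} → L₀ ≤′ L → (∀ {i} → L₀ ≤ i → i < L → ¬ A i) →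
                      countBelow A? L ≡ countBelow A? L₀
  countBelow-stable ≤′-refl                _      = refl
  countBelow-stable (≤′-step {l} L₀≤′l) no-hit with A? l
  ... | yes a = ⊥-elim (no-hit (≤′⇒≤ L₀≤′l) ≤-refl a)
  ... | no  _ =
    trans (+-identityʳ _) (countBelow-stable L₀≤′l λ L₀≤i i<l → no-hit L₀≤i (m≤n⇒m≤1+n i<l))

  sparse⇒countBelow≤ : ∀ {G} → 1 ≤ G → Sparse G A → ∀ L → G * countBelow A? L ≤ L + G
  sparse⇒countBelow≤ {G} 1≤G sparse = <-rec _ bound
    where
    bound : ∀ L → (∀ {L′} → L′ < L → G * countBelow A? L′ ≤ L′ + G) →
            G * countBelow A? L ≤ L + G
    bound zero    _   = ≤-trans (≤-reflexive (*-zeroʳ G)) z≤n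
    bound (suc l) rec with A? l
    ... | no  _ = begin
      G * (countBelow A? l + 0) ≡⟨ cong (G *_) (+-identityʳ _) ⟩
      G * countBelow A? l       ≤⟨ rec ≤-refl ⟩
      l + G                     ≤⟨ +-monoˡ-≤ G (n≤1+n l) ⟩
      suc l + G                 ∎
      where open ≤-Reasoning
    ... | yes a = begin
      G * (countBelow A? l + 1)   ≡⟨ *-distribˡ-+ G _ 1 ⟩
      G * countBelow A? l + G * 1 ≡⟨ cong₂ _+_ (cong (G *_) count≡) (*-identityʳ G) ⟩
      G * countBelow A? L₀ + G    ≤⟨ +-monoˡ-≤ G earlier ⟩
      suc l + G                   ∎
      where
      open ≤-Reasoning
      L₀ : ℕ
      L₀ = suc l ∸ G
      L₀≤l : L₀ ≤ l
      L₀≤l = ∸-monoʳ-≤ (suc l) 1≤G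
      no-hit : ∀ {i} → L₀ ≤ i → i < l → ¬ A i
      no-hit {i} L₀≤i i<l aᵢ = n≮n l (begin-strict
        l      <⟨ m≤n+m∸n (suc l) G ⟩
        G + L₀ ≤⟨ +-monoʳ-≤ G L₀≤i ⟩
        G + i  ≡⟨ +-comm G i ⟩
        i + G  ≤⟨ sparse i<l aᵢ a ⟩
        l      ∎)
      count≡ : countBelow A? l ≡ countBelow A? L₀
      count≡ = countBelow-stable (≤⇒≤′ L₀≤l) no-hit
      earlier : G * countBelow A? L₀ ≤ suc l
      earlier with G ≤? suc l
      ... | yes G≤1+l = ≤-trans (rec (s≤s L₀≤l)) (≤-reflexive (m∸n+n≡m G≤1+l))
      ... | no  G≰1+l = ≤-trans (≤-reflexive (trans (cong (λ x → G * countBelow A? x) L₀≡0) (*-zeroʳ G))) z≤n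
        where
        L₀≡0 : L₀ ≡ 0
        L₀≡0 = m≤n⇒m∸n≡0 (<⇒≤ (≰⇒> G≰1+l))

sumBelow-+ : ∀ f g R → sumBelow (λ q → f q + g q) R ≡ sumBelow f R + sumBelow g R
sumBelow-+ f g zero    = refl
sumBelow-+ f g (suc R) =
  trans (cong (_+ (f R + g R)) (sumBelow-+ f g R)) (interchange (sumBelow f R) (sumBelow g R) (f R) (g R))
  where
  interchange : ∀ a b c d → a + b + (c + d) ≡ a + c + (b + d)
  interchange = solve-∀

sumBelow-mono : ∀ {f g} R → (∀ {q} → q < R → f q ≤ g q) → sumBelow f R ≤ sumBelow g R
sumBelow-mono zero    _   = z≤n
sumBelow-mono (suc R) f≤g = +-mono-≤ (sumBelow-mono R (f≤g ∘ m≤n⇒m≤1+n)) (f≤g ≤-refl)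

term≤sumBelow : ∀ f {q R} → q < R → f q ≤ sumBelow f R
term≤sumBelow f {q} {suc R} q<1+R with m≤n⇒m<n∨m≡n (≤-pred q<1+R)
... | inj₁ q<R  = ≤-trans (term≤sumBelow f q<R) (m≤m+n _ (f R))
... | inj₂ refl = m≤n+m (f q) _

sumBelow-const : ∀ R → sumBelow (λ _ → 1) R ≡ R
sumBelow-const zero    = refl
sumBelow-const (suc R) = trans (cong (_+ 1) (sumBelow-const R)) (+-comm R 1)

2R+3≢0 : ∀ R → NonZero (2 * R + 3)
2R+3≢0 R = subst NonZero (+-comm 3 (2 * R)) _

-- Σ_{q<R} 1/(q+2)² ≤ 2/3 − 2/(2R+3), since 1/(q+2)² ≤ 2/(2q+3) − 2/(2q+5).
sumBelow-inverse-squares : ∀ (c : ℕ → ℕ) L R → (∀ {q} → q < R → P q * P q * c q ≤ L) →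
                           3 * sumBelow c R ≤ 2 * L
sumBelow-inverse-squares c L R bounded =
  *-cancelˡ-≤ (2 * R + 3) {{2R+3≢0 R}} (≤-trans (m≤m+n _ (6 * L)) (telescope R bounded))
  where
  telescope : ∀ R → (∀ {q} → q < R → P q * P q * c q ≤ L) →
              (2 * R + 3) * (3 * sumBelow c R) + 6 * L ≤ (2 * R + 3) * (2 * L)
  telescope zero    _       = ≤-reflexive (six L)
    where
    six : ∀ L → 6 * L ≡ 3 * (2 * L)
    six = solve-∀
  telescope (suc R) bounded = *-cancelˡ-≤ a {{2R+3≢0 R}} (+-cancelʳ-≤ (6 * L * a′) _ _ (begin
    a * (a′ * (3 * (S + c R)) + 6 * L) + 6 * L * a′ ≡⟨ expand a a′ S (c R) L ⟩
    a′ * (a * (3 * S) + 6 * L) + 3 * (a * a′ * c R) + 6 * L * a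
      ≤⟨ +-monoˡ-≤ (6 * L * a) (+-mono-≤ (*-monoʳ-≤ a′ previous) (*-monoʳ-≤ 3 last)) ⟩
    a′ * (a * (2 * L)) + 3 * (4 * L) + 6 * L * a      ≡⟨ collapse R L ⟩
    a * (a′ * (2 * L)) + 6 * L * a′                   ∎))
    where
    open ≤-Reasoning
    a a′ S : ℕ
    a  = 2 * R + 3
    a′ = 2 * suc R + 3
    S  = sumBelow c R
    previous : a * (3 * S) + 6 * L ≤ a * (2 * L)
    previous = telescope R (bounded ∘ m≤n⇒m≤1+n)
    square : ∀ R → 4 * (suc (suc R) * suc (suc R)) ≡ 1 + (2 * R + 3) * (2 * suc R + 3)
    square = solve-∀
    last : a * a′ * c R ≤ 4 * L
    last = begin
      a * a′ * c R          ≤⟨ *-monoˡ-≤ (c R) (m≤n+m (a * a′) 1) ⟩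
      (1 + a * a′) * c R    ≡⟨ cong (_* c R) (square R) ⟨
      4 * (P R * P R) * c R ≡⟨ *-assoc 4 (P R * P R) (c R) ⟩
      4 * (P R * P R * c R) ≤⟨ *-monoʳ-≤ 4 (bounded ≤-refl) ⟩
      4 * L                 ∎
    expand : ∀ a a′ S c L → a * (a′ * (3 * (S + c)) + 6 * L) + 6 * L * a′
                          ≡ a′ * (a * (3 * S) + 6 * L) + 3 * (a * a′ * c) + 6 * L * a
    expand = solve-∀
    collapse : ∀ R L → (2 * suc R + 3) * ((2 * R + 3) * (2 * L)) + 3 * (4 * L) + 6 * L * (2 * R + 3)
                     ≡ (2 * R + 3) * ((2 * suc R + 3) * (2 * L)) + 6 * L * (2 * suc R + 3)
    collapse = solve-∀

module _ {A : ℕ → ℕ → Set} (A? : ∀ q → Decidable (A q)) where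

  covered⇒≤sumBelow-countBelow : ∀ R L → (∀ {i} → i < L → ∃[ q ] q < R × A q i) →
                                 L ≤ sumBelow (λ q → countBelow (A? q) L) R
  covered⇒≤sumBelow-countBelow R zero    _       = z≤n
  covered⇒≤sumBelow-countBelow R (suc L) covered = begin
    suc L                                                         ≡⟨ +-comm 1 L ⟩
    L + 1                                                         ≤⟨ +-mono-≤ previous hit ⟩
    sumBelow (λ q → countBelow (A? q) L) R + sumBelow indicator R ≡⟨ sumBelow-+ _ indicator R ⟨
    sumBelow (λ q → countBelow (A? q) (suc L)) R                  ∎
    where
    open ≤-Reasoning
    previous : L ≤ sumBelow (λ q → countBelow (A? q) L) R
    previous = covered⇒≤sumBelow-countBelow R L (covered ∘ m≤n⇒m≤1+n)
    indicator : ℕ → ℕ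
    indicator q = if does (A? q L) then 1 else 0
    hit : 1 ≤ sumBelow indicator R
    hit with q , q<R , a ← covered ≤-refl with A? q L in A?≡
    ... | yes _ = ≤-trans (≤-reflexive (cong (λ A? → if does A? then 1 else 0) (sym A?≡)))
                          (term≤sumBelow indicator q<R)
    ... | no ¬a = ⊥-elim (¬a a)

  sparse-cover⇒≤ : ∀ R L → (∀ {i} → i < L → ∃[ q ] q < R × A q i) →
                   (∀ {q} → q < R → Sparse (P q * P q) (A q)) → L ≤ 3 * R
  sparse-cover⇒≤ R L covered sparse = +-cancelʳ-≤ (2 * L) L (3 * R) (begin
    L + 2 * L                       ≡⟨ triple L ⟩
    3 * L                           ≤⟨ *-monoʳ-≤ 3 (covered⇒≤sumBelow-countBelow R L covered) ⟩
    3 * sumBelow c R                ≤⟨ *-monoʳ-≤ 3 (sumBelow-mono R (λ _ → m≤n+m∸n (c _) 1)) ⟩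
    3 * sumBelow (λ q → 1 + c′ q) R ≡⟨ cong (3 *_) (trans (sumBelow-+ _ c′ R) (cong (_+ S′) (sumBelow-const R))) ⟩
    3 * (R + S′)                    ≡⟨ *-distribˡ-+ 3 R S′ ⟩
    3 * R + 3 * S′                  ≤⟨ +-monoʳ-≤ (3 * R) (sumBelow-inverse-squares c′ L R bounded) ⟩
    3 * R + 2 * L                   ∎)
    where
    open ≤-Reasoning
    c c′ : ℕ → ℕ
    c q = countBelow (A? q) L
    c′ q = c q ∸ 1
    S′ : ℕ
    S′ = sumBelow c′ R
    bounded : ∀ {q} → q < R → P q * P q * c′ q ≤ L
    bounded {q} q<R = begin
      P q * P q * (c q ∸ 1)           ≡⟨ *-distribˡ-∸ (P q * P q) (c q) 1 ⟩
      P q * P q * c q ∸ P q * P q * 1 ≡⟨ cong (P q * P q * c q ∸_) (*-identityʳ (P q * P q)) ⟩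
      P q * P q * c q ∸ P q * P q     ≤⟨ ∸-monoˡ-≤ (P q * P q) (sparse⇒countBelow≤ (A? q) z<s (sparse q<R) L) ⟩
      L + P q * P q ∸ P q * P q       ≡⟨ m+n∸n≡m L (P q * P q) ⟩
      L                               ∎
    triple : ∀ L → L + 2 * L ≡ 3 * L
    triple = solve-∀

-- Shifts along an arithmetic progression

m*m<n*n⇒m<n : ∀ {m n} → m * m < n * n → m < n
m*m<n*n⇒m<n {m} {n} m²<n² with m <? n
... | yes m<n = m<n
... | no  m≮n = ⊥-elim (<⇒≱ m²<n² (*-mono-≤ (≮⇒≥ m≮n) (≮⇒≥ m≮n)))

coprime-gap : ∀ {G M x i j} → Coprime G M → G ∣ x + i * M → G ∣ x + j * M → i < j → i + G ≤ j
coprime-gap {G} {M} {x} {i} G⊥M G∣xᵢ G∣xⱼ i<j with e , refl ← m≤n⇒∃[o]m+o≡n i<j =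
  ≤-trans (+-monoʳ-≤ i (∣⇒≤ G∣1+e)) (≤-reflexive (+-suc i e))
  where
  shift : ∀ x i e M → x + (suc i + e) * M ≡ x + i * M + suc e * M
  shift = solve-∀
  G∣1+e : G ∣ suc e
  G∣1+e = coprime-divisor G⊥M
    (∣-trans (∣m+n∣m⇒∣n (subst (G ∣_) (shift x i e M) G∣xⱼ) G∣xᵢ) (∣-reflexive (*-comm (suc e) M)))

m<[1+m/n]*n : ∀ m n .{{_ : NonZero n}} → m < suc (m / n) * n
m<[1+m/n]*n m n = begin-strict
  m                 ≡⟨ m≡m%n+[m/n]*n m n ⟩
  m % n + m / n * n <⟨ +-monoˡ-< (m / n * n) (m%n<n m n) ⟩
  n + m / n * n     ∎
  where open ≤-Reasoning

1≤N<[1+r]²⇒1≤r : ∀ {N r} → 1 ≤ N → N < suc r * suc r → 1 ≤ r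
1≤N<[1+r]²⇒1≤r {r = zero}  1≤N (s≤s N≤0) with () ← ≤-trans 1≤N N≤0
1≤N<[1+r]²⇒1≤r {r = suc _} _   _         = s≤s z≤n

module Progression
  {k m d q a b j₀ c r : ℕ}
  (same-shapes : ∀ {j} → j ≤ k → t (m + j) ≡ t (m + d + j))
  (p-prime : Prime (P q)) (p^b∥d : P q ^ b ∥ d)
  (b<a : b < a) (2≤a : 2 ≤ a) (t[a]≢t[b] : t a ≢ t b)
  (j₀<M : j₀ < P q ^ suc a) (m+j₀≡ : m + j₀ ≡ P q ^ a + c * P q ^ suc a)
  (below-square : m + d + k < suc r * suc r)
  where

  M : ℕ
  M = P q ^ suc a

  instance
    M≢0 : NonZero M
    M≢0 = m^n≢0 (P q) (suc a)

  jᵢ : ℕ → ℕ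
  jᵢ i = j₀ + i * M

  jᵢ≤k : ∀ {i} → i < k / M → jᵢ i ≤ k
  jᵢ≤k {i} i<k/M = begin
    j₀ + i * M ≤⟨ <⇒≤ (+-monoˡ-< (i * M) j₀<M) ⟩
    suc i * M  ≤⟨ *-monoˡ-≤ M i<k/M ⟩
    k / M * M  ≤⟨ m/n*n≤m k M ⟩
    k          ∎
    where open ≤-Reasoning

  lower-exact : ∀ i → P q ^ a ∥ m + jᵢ i
  lower-exact i = subst (P q ^ a ∥_) (sym (begin
    m + (j₀ + i * M)          ≡⟨ +-assoc m j₀ (i * M) ⟨
    m + j₀ + i * M            ≡⟨ cong (_+ i * M) m+j₀≡ ⟩
    P q ^ a + c * M + i * M   ≡⟨ +-assoc (P q ^ a) (c * M) (i * M) ⟩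
    P q ^ a + (c * M + i * M) ≡⟨ cong (P q ^ a +_) (*-distribʳ-+ M c i) ⟨
    P q ^ a + (c + i) * M     ∎)) (P^a∥P^a+c*P^[1+a] q a (c + i))
    where open ≡-Reasoning

  upper-exact : ∀ i → P q ^ b ∥ m + d + jᵢ i
  upper-exact i = subst (P q ^ b ∥_) (swap m (jᵢ i) d)
                        (∥-+ p^b∥d (∣-trans (^-monoʳ-∣ (P q) b<a) (∥⇒∣ (lower-exact i))))
    where
    swap : ∀ x y z → x + y + z ≡ x + z + y
    swap = solve-∀

  distinct-valuation-shapes : ∀ i → t (val q (m + jᵢ i)) ≢ t (val q (m + d + jᵢ i))
  distinct-valuation-shapes i = subst₂ (λ u v → t u ≢ t v) (sym (∥⇒val≡ q _ (lower-exact i)))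
                                                          (sym (∥⇒val≡ q _ (upper-exact i))) t[a]≢t[b]

  SquareFactor : ℕ → ℕ → Set
  SquareFactor q′ i = P q′ * P q′ ∣ m + d + jᵢ i × ¬ P q ∣ P q′

  squareFactor? : ∀ q′ → Decidable (SquareFactor q′)
  squareFactor? q′ i = (P q′ * P q′ ∣? m + d + jᵢ i) ×-dec ¬? (P q ∣? P q′)

  square-factor< : ∀ {i q′} → i < k / M → P q′ * P q′ ∣ m + d + jᵢ i → q′ < r
  square-factor< {i} {q′} i<k/M sq∣ = <⇒≤ (≤-pred (m*m<n*n⇒m<n {P q′} {suc r} (begin-strict
    P q′ * P q′   ≤⟨ ∣⇒≤ {{∥⇒nonZero (upper-exact i)}} sq∣ ⟩
    m + d + jᵢ i  ≤⟨ +-monoʳ-≤ (m + d) (jᵢ≤k i<k/M) ⟩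
    m + d + k     <⟨ below-square ⟩
    suc r * suc r ∎)))
    where open ≤-Reasoning

  covered : ∀ {i} → i < k / M → ∃[ q′ ] q′ < r × SquareFactor q′ i
  covered {i} i<k/M = from-square-factor (same-shape⇒square-factor p-prime (same-shapes (jᵢ≤k i<k/M))
                                           (subst (2 ≤_) (sym (∥⇒val≡ q _ (lower-exact i))) 2≤a)
                                           (distinct-valuation-shapes i))
    where
    from-square-factor : ∃[ q′ ] Prime (P q′) × q′ ≢ q × P q′ * P q′ ∣ m + d + jᵢ i →
                         ∃[ q′ ] q′ < r × SquareFactor q′ i
    from-square-factor (q′ , q′-prime , q′≢q , sq∣) = q′ , square-factor< i<k/M sq∣ , sq∣ ,
      λ p∣p′ → q′≢q (sym (suc-injective (suc-injective (prime∣prime⇒≡ p-prime q′-prime p∣p′))))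

  sparse : ∀ {q′} → q′ < r → Sparse (P q′ * P q′) (SquareFactor q′)
  sparse {q′} _ {i} {j} i<j (sq∣ᵢ , p∤p′) (sq∣ⱼ , _) =
    coprime-gap (Coprime.sym (coprime-*ʳ M⊥p′ M⊥p′)) (reassociate i sq∣ᵢ) (reassociate j sq∣ⱼ) i<j
    where
    M⊥p′ : Coprime M (P q′)
    M⊥p′ = Coprime.sym (coprime-^ʳ (suc a) (Coprime.sym (prime∤⇒coprime p-prime p∤p′)))
    reassociate : ∀ l → P q′ * P q′ ∣ m + d + jᵢ l → P q′ * P q′ ∣ m + d + j₀ + l * M
    reassociate l = subst (P q′ * P q′ ∣_) (sym (+-assoc (m + d) j₀ (l * M)))

  k≤4rM : k ≤ 4 * r * M
  k≤4rM = begin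
    k               ≤⟨ <⇒≤ (m<[1+m/n]*n k M) ⟩
    suc (k / M) * M ≤⟨ *-monoˡ-≤ M (s≤s k/M≤3r) ⟩
    suc (3 * r) * M ≤⟨ *-monoˡ-≤ M (+-monoˡ-≤ (3 * r) 1≤r) ⟩
    (r + 3 * r) * M ≡⟨ cong (_* M) (four r) ⟩
    4 * r * M       ∎
    where
    open ≤-Reasoning
    k/M≤3r : k / M ≤ 3 * r
    k/M≤3r = sparse-cover⇒≤ squareFactor? r (k / M) covered sparse
    1≤r : 1 ≤ r
    1≤r = 1≤N<[1+r]²⇒1≤r 1≤m+d+k below-square
      where
      1≤m+d+k : 1 ≤ m + d + k
      1≤m+d+k = ≤-trans (>-nonZero⁻¹ d {{∥⇒nonZero p^b∥d}}) (≤-trans (m≤n+m d m) (m≤m+n (m + d) k))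
    four : ∀ r → r + 3 * r ≡ 4 * r
    four = solve-∀

isqrt : ∀ N → ∃[ r ] r * r ≤ N × N < suc r * suc r
isqrt zero    = 0 , z≤n , s≤s z≤n
isqrt (suc N) with r , r²≤N , N<[1+r]² ← isqrt N with suc r * suc r ≤? suc N
... | yes [1+r]²≤1+N =
  suc r , [1+r]²≤1+N , ≤-trans (s≤s N<[1+r]²) (≤-trans (m≤m+n _ (2 * r + 2)) (≤-reflexive (next r)))
  where
  next : ∀ r → suc (suc r * suc r) + (2 * r + 2) ≡ suc (suc r) * suc (suc r)
  next = solve-∀
... | no  [1+r]²≰1+N = r , m≤n⇒m≤1+n r²≤N , ≰⇒> [1+r]²≰1+N

fourth-power-bound : ∀ {K k n r w} → k ≤ K * r * w → r * r ≤ n + k → w * w * (w * w) ≤ n →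
                     k * k * (k * k) ≤ K * K * (K * K) * ((n + k) * (n + k)) * n
fourth-power-bound {K} {k} {n} {r} {w} k≤Krw r²≤n+k w⁴≤n = begin
  k * k * (k * k)                                         ≤⟨ fourth-mono k≤Krw ⟩
  K * r * w * (K * r * w) * (K * r * w * (K * r * w))     ≡⟨ regroup K r w ⟩
  K * K * (K * K) * (r * r * (r * r)) * (w * w * (w * w))
    ≤⟨ *-mono-≤ (*-monoʳ-≤ (K * K * (K * K)) (*-mono-≤ r²≤n+k r²≤n+k)) w⁴≤n ⟩
  K * K * (K * K) * ((n + k) * (n + k)) * n               ∎
  where
  open ≤-Reasoning
  fourth-mono : ∀ {x y} → x ≤ y → x * x * (x * x) ≤ y * y * (y * y)
  fourth-mono x≤y = let x²≤y² = *-mono-≤ x≤y x≤y in *-mono-≤ x²≤y² x²≤y²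
  regroup : ∀ K r w → K * r * w * (K * r * w) * (K * r * w * (K * r * w))
                    ≡ K * K * (K * K) * (r * r * (r * r)) * (w * w * (w * w))
  regroup = solve-∀

quartic-bound : ∀ {T k n} → 1 ≤ T → 1 ≤ n → k * k * (k * k) ≤ T * ((n + k) * (n + k)) * n →
                k * k * (k * k) ≤ 16 * (T * T) * (n * n * n)
quartic-bound {T} {k} {n} 1≤T 1≤n k⁴≤ with ≤-total k n
... | inj₁ k≤n = begin
  k * k * (k * k)             ≤⟨ k⁴≤ ⟩
  T * ((n + k) * (n + k)) * n ≤⟨ *-monoˡ-≤ n (*-monoʳ-≤ T (*-mono-≤ n+k≤2n n+k≤2n)) ⟩
  T * ((n + n) * (n + n)) * n ≡⟨ four T n ⟩
  4 * T * (n * n * n)         ≤⟨ *-monoˡ-≤ (n * n * n) (*-mono-≤ (m≤m+n 4 12) T≤T*T) ⟩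
  16 * (T * T) * (n * n * n)  ∎
  where
  open ≤-Reasoning
  n+k≤2n : n + k ≤ n + n
  n+k≤2n = +-monoʳ-≤ n k≤n
  T≤T*T : T ≤ T * T
  T≤T*T = m≤m*n T T {{>-nonZero 1≤T}}
  four : ∀ T n → T * ((n + n) * (n + n)) * n ≡ 4 * T * (n * n * n)
  four = solve-∀
... | inj₂ n≤k = begin
  k * k * (k * k)            ≤⟨ *-mono-≤ k²≤4Tn k²≤4Tn ⟩
  4 * T * n * (4 * T * n)    ≡⟨ sixteen T n ⟩
  16 * (T * T) * (n * n)     ≤⟨ *-monoʳ-≤ (16 * (T * T)) (m≤m*n (n * n) n {{>-nonZero 1≤n}}) ⟩
  16 * (T * T) * (n * n * n) ∎
  where
  open ≤-Reasoning
  1≤k : 1 ≤ k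
  1≤k = ≤-trans 1≤n n≤k
  n+k≤2k : n + k ≤ k + k
  n+k≤2k = +-monoˡ-≤ k n≤k
  factor : ∀ T k n → T * ((k + k) * (k + k)) * n ≡ k * k * (4 * T * n)
  factor = solve-∀
  k²≤4Tn : k * k ≤ 4 * T * n
  k²≤4Tn = *-cancelˡ-≤ (k * k) {{>-nonZero (*-mono-≤ 1≤k 1≤k)}} (begin
    k * k * (k * k)             ≤⟨ k⁴≤ ⟩
    T * ((n + k) * (n + k)) * n ≤⟨ *-monoˡ-≤ n (*-monoʳ-≤ T (*-mono-≤ n+k≤2k n+k≤2k)) ⟩
    T * ((k + k) * (k + k)) * n ≡⟨ factor T k n ⟩
    k * k * (4 * T * n)         ∎)
  sixteen : ∀ T n → 4 * T * n * (4 * T * n) ≡ 16 * (T * T) * (n * n)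
  sixteen = solve-∀

x^4≡ : ∀ x → x ^ 4 ≡ x * x * (x * x)
x^4≡ x = trans (cong (λ y → x * (x * (x * y))) (*-identityʳ x)) (reassociate x)
  where
  reassociate : ∀ x → x * (x * (x * x)) ≡ x * x * (x * x)
  reassociate = solve-∀

x^3≡ : ∀ x → x ^ 3 ≡ x * x * x
x^3≡ x = trans (cong (λ y → x * (x * y)) (*-identityʳ x)) (sym (*-assoc x x x))

prime-power-step : ∀ {q a b} → P q ≤ 7 → a ≤ b + 3 → P q ^ suc a ≤ 7 ^ 4 * P q ^ b
prime-power-step {q} {a} {b} p≤7 a≤b+3 = begin
  P q ^ suc a       ≤⟨ ^-monoʳ-≤ (P q) (s≤s (≤-trans a≤b+3 (≤-reflexive (+-comm b 3)))) ⟩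
  P q ^ (4 + b)     ≡⟨ ^-distribˡ-+-* (P q) 4 b ⟩
  P q ^ 4 * P q ^ b ≤⟨ *-monoˡ-≤ (P q ^ b) (^-monoˡ-≤ 4 p≤7) ⟩
  7 ^ 4 * P q ^ b   ∎
  where open ≤-Reasoning

-- The offsets q of the primes P q = 2, 3, 5, 7.
smallPrimes : List ℕ
smallPrimes = 0 ∷ 1 ∷ 3 ∷ 5 ∷ []

smallPrimes-unique : Unique smallPrimes
smallPrimes-unique = from-yes (unique? smallPrimes)

smallPrimes-prime : All (Prime ∘ P) smallPrimes
smallPrimes-prime = from-yes (All.all? (prime? ∘ P) smallPrimes)

smallPrimes-≤7 : All (λ q → P q ≤ 7) smallPrimes
smallPrimes-≤7 = from-yes (All.all? (λ q → P q ≤? 7) smallPrimes)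

-- Opaque: type checking its uses below would otherwise unfold the whole proof and exhaust memory.
opaque
  smallPrimes-power : ∀ d .{{_ : NonZero d}} → ∃[ q ] q ∈ smallPrimes × (P q ^ val q d) ^ 4 ≤ d
  smallPrimes-power d = smallest-prime-power d 0 (1 ∷ 3 ∷ 5 ∷ []) smallPrimes-unique smallPrimes-prime

K₀ T₀ C₀ : ℕ
K₀ = 4 * 7 ^ 4
T₀ = K₀ * K₀ * (K₀ * K₀)
C₀ = 16 * (T₀ * T₀)

k≤4rM⇒k≤K₀rw : ∀ {k r M w} → k ≤ 4 * r * M → M ≤ 7 ^ 4 * w → k ≤ K₀ * r * w
k≤4rM⇒k≤K₀rw {k} {r} {M} {w} k≤4rM M≤7⁴w = begin
  k                 ≤⟨ k≤4rM ⟩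
  4 * r * M         ≤⟨ *-monoʳ-≤ (4 * r) M≤7⁴w ⟩
  4 * r * (7 ^ 4 * w) ≡⟨ regroup r w ⟩
  K₀ * r * w        ∎
  where
  open ≤-Reasoning
  regroup : ∀ r w → 4 * r * (2401 * w) ≡ 9604 * r * w
  regroup = solve-∀

shape-shift-bound : ∀ k m n → m < n → (∀ j → j ≤ k → t (m + j) ≡ t (n + j)) →
                    k * k * (k * k) ≤ C₀ * (n * n * n)
shape-shift-bound k m n m<n same-shapes =
  let q , q∈ , w⁴≤d                    = smallPrimes-power d
      a , b<a , a≤b+3 , 2≤a , t[a]≢t[b] = nearby-distinct-shape (val q d)
      j₀ , j₀<M , c , m+j₀≡            = shift-to-residue m {{m^n≢0 (P q) (suc a)}}
                                                          (^-monoʳ-< (P q) (1<P q) (n<1+n a))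
      r , r²≤n+k , n+k<[1+r]²          = isqrt (n + k)
      w : ℕ
      w = P q ^ val q d
      k≤4rM : k ≤ 4 * r * P q ^ suc a
      k≤4rM = Progression.k≤4rM {c = c} {r = r}
                (λ {j} j≤k → trans (same-shapes j j≤k) (cong (λ x → t (x + j)) (sym m+d≡n)))
                (All.lookup smallPrimes-prime q∈) (val-∥ q d) b<a 2≤a t[a]≢t[b] j₀<M m+j₀≡
                (subst (λ x → x + k < suc r * suc r) (sym m+d≡n) n+k<[1+r]²)
      M≤7⁴w : P q ^ suc a ≤ 7 ^ 4 * w
      M≤7⁴w = prime-power-step (All.lookup smallPrimes-≤7 q∈) a≤b+3
      w⁴≤n : w * w * (w * w) ≤ n
      w⁴≤n = ≤-trans (≤-reflexive (sym (x^4≡ w))) (≤-trans w⁴≤d (m∸n≤m n m))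
      k≤K₀rw : k ≤ K₀ * r * w
      k≤K₀rw = k≤4rM⇒k≤K₀rw {k} {r} {P q ^ suc a} {w} k≤4rM M≤7⁴w
  in quartic-bound {T₀} (s≤s z≤n) 1≤n (fourth-power-bound {K₀} {k} {n} {r} {w} k≤K₀rw r²≤n+k w⁴≤n)
  where
  d : ℕ
  d = n ∸ m
  instance
    d≢0 : NonZero d
    d≢0 = >-nonZero (m<n⇒0<n∸m m<n)
  m+d≡n : m + d ≡ n
  m+d≡n = m+[n∸m]≡n (<⇒≤ m<n)
  1≤n : 1 ≤ n
  1≤n = ≤-trans (s≤s z≤n) m<n

m≤m*⌊log₂n⌋^e : ∀ m e {n} → 2 ≤ n → m ≤ m * ⌊log₂ n ⌋ ^ e
m≤m*⌊log₂n⌋^e m e {n} 2≤n = m≤m*n m (⌊log₂ n ⌋ ^ e) {{m^n≢0 _ e {{>-nonZero 1≤log}}}}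
  where
  1≤log : 1 ≤ ⌊log₂ n ⌋
  1≤log = subst (_≤ ⌊log₂ n ⌋) (⌊log₂[2^n]⌋≡n 1) (⌊log₂⌋-mono-≤ 2≤n)

theorem12 : ∃ λ (C : ℕ) → ∀ (k m n : ℕ) → 1 ≤ k → 1 ≤ m → m < n →
              (∀ (j : ℕ) → j ≤ k → t (m + j) ≡ t (n + j)) →
              k ^ 4 ≤ C * (n ^ 3 * ⌊log₂ n ⌋ ^ 6)
theorem12 = C₀ , λ k m n _ 1≤m m<n same-shapes → begin
  k ^ 4                        ≡⟨ x^4≡ k ⟩
  k * k * (k * k)              ≤⟨ shape-shift-bound k m n m<n same-shapes ⟩
  C₀ * (n * n * n)             ≡⟨ cong (C₀ *_) (x^3≡ n) ⟨
  C₀ * n ^ 3                   ≤⟨ *-monoʳ-≤ C₀ (m≤m*⌊log₂n⌋^e (n ^ 3) 6 (≤-trans (s≤s 1≤m) m<n)) ⟩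
  C₀ * (n ^ 3 * ⌊log₂ n ⌋ ^ 6) ∎
  where open ≤-Reasoning
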